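{- Fix $k \ge 2$ and $n \ge 1$. Let $X_1,\dots,X_k$ be disjoint sets each identified with $[n]$, and let $H_k$ be the $(k+1)$-uniform hypergraph with vertex set $X_1 \times \cdots \times X_k$ whose edges are the $(k+1)$-element sets $A \subseteq X_1 \times \cdots \times X_k$ that, viewed as the edge set of a $k$-partite $k$-uniform hypergraph with parts $X_1,\dots,X_k$, form a positive strong $k$-simplex. Then $H_k$ has $N = n^k$ vertices, maximum degree $\Delta \le (k+1)n^k$, independence number $\alpha(H_k) \le 2kn^{k-1} \le 2k(k+1)^{1/k}\frac{N}{\Delta^{1/k}}$, chromatic number $\chi(H_k) \ge \frac{\Delta^{1/k}}{2k(k+1)^{1/k}}$, and $H_k$ contains no copy of $T_{k+1}$.
   Context: A strong $k$-simplex is the $k$-uniform hypergraph with vertex set $\{v_1,v_1',\dots,v_k,v_k'\}$ and edges $e=\{v_1,\dots,v_k\}$ and $e_i = (e\setminus\{v_i\})\cup\{v_i'\}$, $i=1,\dots,k$. It is a positive strong $k$-simplex (with respect to parts $X_1,\dots,X_k$, each identified with $[n]$) if $v_i,v_i' \in X_i$ and $v_i' > v_i$ for all $i$. An independent set is a vertex set containing no edge; $\alpha$ is the maximum size of one; $\chi$ is the minimum number of independent sets partitioning the vertex set. The degree of a vertex is the number of edges containing it. $T_{k+1}$ is the $(k+1)$-uniform hypergraph with $k+2$ edges $e_1,\dots,e_{k+1},f$ such that for some set $S$ with $|S| = k$, $e_i \cap e_j = S$ for all $i \ne j$, and $f \supseteq e_i \setminus S$ for all $i$ (so $f$ consists of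 the $k+1$ vertices $e_i \setminus S$). -}

module Defs where

open import Level using (0ℓ)
open import Data.Nat using (ℕ; suc; _≤_)
open import Data.Fin using (Fin) renaming (_<_ to _<ᶠ_)
open import Data.Vec using (Vec; lookup; _[_]≔_; toList)
open import Data.List using (List; length; _++_)
open import Data.List.Membership.Propositional using (_∈_)
open import Data.List.Relation.Unary.All using (All)
open import Data.List.Relation.Unary.AllPairs using (AllPairs)
open import Data.List.Relation.Unary.Unique.Propositional using (Unique)
open import Data.Product using (Σ; ∃; ∃-syntax; _×_)
open import Data.Sum using (_⊎_)
open import Relation.Nullary using (¬_)
open import Relation.Binary.PropositionalEquality using (_≡_)
open import Function.Bundles using (_⇔_)

Vertex : ℕ → ℕ → Set
Vertex k n = Vec (Fin n) k

VSet : ℕ → ℕ → Set₁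
VSet k n = Vertex k n → Set

IsPositiveStrongSimplex : ∀ {k n} → VSet k n → Set
IsPositiveStrongSimplex {k} {n} E =
  Σ (Vertex k n) λ v → Σ (Vertex k n) λ w →
    ((i : Fin k) → lookup v i <ᶠ lookup w i) ×
    ((u : Vertex k n) → E u ⇔ (u ≡ v ⊎ ∃[ i ] (u ≡ (v [ i ]≔ lookup w i))))

IsEdge : ∀ {k n} → VSet k n → Set
IsEdge E = IsPositiveStrongSimplex E

DistinctSets : ∀ {k n} → VSet k n → VSet k n → Set
DistinctSets {k} {n} E F = ¬ ((u : Vertex k n) → E u ⇔ F u)

DegreeAtLeast : ∀ {k n} → Vertex k n → ℕ → Set₁
DegreeAtLeast {k} {n} x m =
  Σ (List (VSet k n)) λ Es →
    (length Es ≡ m) × All (λ E → IsEdge E × E x) Es × AllPairs DistinctSets Es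

IsMaxDegree : (k n : ℕ) → ℕ → Set₁
IsMaxDegree k n d =
  (Σ (Vertex k n) λ x → DegreeAtLeast x d) ×
  ((x : Vertex k n) → ¬ DegreeAtLeast x (suc d))

Independent : ∀ {k n} → List (Vertex k n) → Set₁
Independent {k} {n} xs =
  (E : VSet k n) → IsEdge E → ¬ ((u : Vertex k n) → E u → u ∈ xs)

IsIndependenceNumber : (k n : ℕ) → ℕ → Set₁
IsIndependenceNumber k n a =
  (Σ (List (Vertex k n)) λ xs → Unique xs × Independent xs × length xs ≡ a) ×
  ((xs : List (Vertex k n)) → Unique xs → Independent xs → length xs ≤ a)

ProperColouring : (k n m : ℕ) → (Vertex k n → Fin m) → Set₁
ProperColouring k n m c =
  (E : VSet k n) → IsEdge E → ¬ (Σ (Fin m) λ j → (u : Vertex k n) → E u → c u ≡ j)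

IsChromaticNumber : (k n : ℕ) → ℕ → Set₁
IsChromaticNumber k n χ =
  (Σ (Vertex k n → Fin χ) λ c → ProperColouring k n χ c) ×
  ((m : ℕ) (c : Vertex k n → Fin m) → ProperColouring k n m c → χ ≤ m)

ContainsT : (k n : ℕ) → Set
ContainsT k n =
  Σ (Vec (Vertex k n) k) λ s → Σ (Vec (Vertex k n) (suc k)) λ a →
    Unique (toList s ++ toList a) ×
    ((i : Fin (suc k)) →
       IsEdge (λ u → (∃[ j ] (u ≡ lookup s j)) ⊎ (u ≡ lookup a i))) ×
    IsEdge (λ u → ∃[ j ] (u ≡ lookup a j))

-- * Degree.  An edge through x is determined by the role of x in it (apex, or
--   i-th tip) and one further vector (w, or w with its i-th entry swapped with
--   v's), so Δ ≤ (k+1)·n^k.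
-- * Independence.  If S contains no edge then every x ∈ S has a direction i in
--   which no point of S lies strictly above x on the axis-parallel line through
--   x (otherwise those points and x form an edge of S).  Two such "top points"
--   with the same direction on the same line coincide, so x ↦ (i, x without its
--   i-th coordinate) is injective and |S| ≤ k·n^(k-1).  Applied to the colour
--   classes of a proper colouring this gives n^k ≤ χ·k·n^(k-1).
-- * No T_{k+1}.  In a simplex at most one vertex leaves the apex value in a
--   given coordinate.  Take a coordinate l where two vertices of S differ: all
--   the a_i then share the value min(s_l, s'_l) at l, contradicting the fact
--   that the edge {a_1,…,a_{k+1}} contains two vertices differing at l.

module Submission where

open import Defs
open import Data.Nat using (ℕ; suc; _+_; _*_; _∸_; _^_; _≤_)
open import Data.Fin using (Fin)
open import Data.Product using (_×_)
open import Relation.Nullary using (¬_)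
open import Function.Bundles using (_↔_)

open import Level using (Level)
open import Data.Nat using (zero; z≤n; s≤s)
open import Data.Nat.Properties
  using (+-comm; *-assoc; *-monoˡ-≤; *-monoʳ-≤; ^-monoˡ-≤; ^-zeroˡ; *-identityˡ; m≤m+n;
         *-cancelʳ-≤; m^n≢0; ≤-trans; ≤-reflexive; <⇒≤; module ≤-Reasoning)
open import Data.Nat.Tactic.RingSolver using (solve-∀)
open import Data.Fin using (zero; suc; combine; _≟_; punchOut)
  renaming (_<_ to _<ᶠ_; _≤_ to _≤ᶠ_)
open import Data.Fin.Properties
  using (combine-injective; injective⇒≤; any?; ¬∀⟶∃¬; <-cmp; <-irrefl)
  renaming (_<?_ to _<ᶠ?_; ≤-antisym to ≤ᶠ-antisym; ≤-refl to ≤ᶠ-refl; ≤-reflexive to ≤ᶠ-reflexive)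
open import Data.Vec using (Vec; _∷_; lookup; _[_]≔_; tabulate; removeAt; toList)
open import Data.Vec.Properties
  using (≡-dec; lookup∘update; lookup∘update′; lookup∘tabulate; tabulate∘lookup;
         tabulate-cong; removeAt-punchOut; []≔-lookup; []≔-idempotent)
open import Data.Vec.Recursive using (Fin[m^n]↔Fin[m]^n)
open import Data.Vec.Recursive.Properties using (↔Vec)
import Data.Vec.Membership.Propositional.Properties as VecMembership
open import Data.List as List using (List; length)
open import Data.List.Relation.Unary.All as All using (All)
open import Data.List.Relation.Unary.All.Properties using (++⁻ʳ)
open import Data.List.Relation.Unary.AllPairs using (AllPairs; _∷_)
open import Data.List.Relation.Unary.Unique.Propositional using (Unique)
open import Data.List.Membership.Propositional using (_∈_)
open import Data.List.Membership.Propositional.Properties using (∈-lookup)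
open import Data.List.Membership.DecPropositional using (_∈?_)
open import Data.Product using (∃; _,_; proj₁; proj₂)
open import Data.Sum as Sum using (_⊎_; inj₁; inj₂)
open import Data.Empty using (⊥-elim)
open import Relation.Binary using (tri<; tri≈; tri>)
open import Relation.Binary.Definitions using (DecidableEquality)
open import Relation.Binary.PropositionalEquality
open import Relation.Nullary using (Dec; yes; no)
open import Relation.Nullary.Decidable using (_×-dec_)
open import Function using (_∘_)
open import Function.Bundles using (Inverse; _⇔_; mk⇔; Equivalence)
open import Function.Properties.Inverse using (↔-trans)

private variable
  ℓ ℓᴾ ℓᴿ : Level
  A : Set ℓ

vec-ext : ∀ {m} (x y : Vec A m) → (∀ j → lookup x j ≡ lookup y j) → x ≡ y
vec-ext x y h = trans (sym (tabulate∘lookup x)) (trans (tabulate-cong h) (tabulate∘lookup y))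

differing-coordinate : DecidableEquality A → ∀ {m} {x y : Vec A m} → x ≢ y →
  ∃ λ l → lookup x l ≢ lookup y l
differing-coordinate _≟ᴬ_ {m} {x} {y} x≢y =
  ¬∀⟶∃¬ m _ (λ l → lookup x l ≟ᴬ lookup y l) (x≢y ∘ vec-ext x y)

swapAt : ∀ {m} → Fin m → Vec A m × Vec A m → Vec A m × Vec A m
swapAt i (p , q) = p [ i ]≔ lookup q i , q [ i ]≔ lookup p i

swapAt-involutive : ∀ {m} (i : Fin m) (pq : Vec A m × Vec A m) → swapAt i (swapAt i pq) ≡ pq
swapAt-involutive i (p , q) = cong₂ _,_ (restore p q) (restore q p)
  where
  open ≡-Reasoning
  restore : ∀ p q → (p [ i ]≔ lookup q i) [ i ]≔ lookup (q [ i ]≔ lookup p i) i ≡ p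
  restore p q = begin
    (p [ i ]≔ lookup q i) [ i ]≔ lookup (q [ i ]≔ lookup p i) i
      ≡⟨ cong ((p [ i ]≔ lookup q i) [ i ]≔_) (lookup∘update i q (lookup p i)) ⟩
    (p [ i ]≔ lookup q i) [ i ]≔ lookup p i  ≡⟨ []≔-idempotent p i ⟩
    p [ i ]≔ lookup p i                      ≡⟨ []≔-lookup p i ⟩
    p                                        ∎

same-line : ∀ {m} (x y : Vec A (suc m)) (i : Fin (suc m)) →
  removeAt x i ≡ removeAt y i → y ≡ x [ i ]≔ lookup y i
same-line x y i e = vec-ext y (x [ i ]≔ lookup y i) agree
  where
  agree : ∀ j → lookup y j ≡ lookup (x [ i ]≔ lookup y i) j
  agree j with i ≟ j
  ... | yes refl = sym (lookup∘update i x (lookup y i))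
  ... | no i≢j = begin
    lookup y j                            ≡⟨ sym (removeAt-punchOut y i≢j) ⟩
    lookup (removeAt y i) (punchOut i≢j)  ≡⟨ cong (λ z → lookup z (punchOut i≢j)) (sym e) ⟩
    lookup (removeAt x i) (punchOut i≢j)  ≡⟨ removeAt-punchOut x i≢j ⟩
    lookup x j                            ≡⟨ sym (lookup∘update′ (i≢j ∘ sym) x (lookup y i)) ⟩
    lookup (x [ i ]≔ lookup y i) j        ∎
    where open ≡-Reasoning

vertexBijection : ∀ k n → Fin (n ^ k) ↔ Vertex k n
vertexBijection k n = ↔-trans (Fin[m^n]↔Fin[m]^n n k) (↔Vec k)

vertexIndex : ∀ {k n} → Vertex k n → Fin (n ^ k)
vertexIndex {k} {n} = Inverse.from (vertexBijection k n)

vertexIndex-injective : ∀ {k n} {x y : Vertex k n} → vertexIndex x ≡ vertexIndex y → x ≡ y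
vertexIndex-injective {k} {n} {x} {y} eq =
  trans (sym (strictlyInverseˡ x)) (trans (cong to eq) (strictlyInverseˡ y))
  where open Inverse (vertexBijection k n)

vertexOf : ∀ {k n} → Fin (n ^ k) → Vertex k n
vertexOf {k} {n} = Inverse.to (vertexBijection k n)

vertexOf-injective : ∀ {k n} {i j : Fin (n ^ k)} → vertexOf {k} i ≡ vertexOf j → i ≡ j
vertexOf-injective {k} {n} {i} {j} eq =
  trans (sym (strictlyInverseʳ i)) (trans (cong from eq) (strictlyInverseʳ j))
  where open Inverse (vertexBijection k n)

pairIndex : ∀ {a m n} → Fin a → Vertex m n → Fin (a * n ^ m)
pairIndex {a} {m} {n} i x = combine {a} {n ^ m} i (vertexIndex x)

pairIndex-injective : ∀ {a m n} (i j : Fin a) (x y : Vertex m n) →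
  pairIndex i x ≡ pairIndex j y → i ≡ j × x ≡ y
pairIndex-injective {a} {m} {n} _ _ _ _ eq with combine-injective {a} {n ^ m} _ _ _ _ eq
... | i≡j , e = i≡j , vertexIndex-injective e

allPairs-lookup : ∀ {R : A → A → Set ℓᴿ} {xs : List A} → AllPairs R xs →
  ∀ {i j} → i <ᶠ j → R (List.lookup xs i) (List.lookup xs j)
allPairs-lookup (h ∷ _) {zero} {suc j} _ = All.lookup h (∈-lookup j)
allPairs-lookup (_ ∷ t) {suc i} {suc j} (s≤s i<j) = allPairs-lookup t i<j

length≤-by-code : ∀ {P : A → Set ℓᴾ} {R : A → A → Set ℓᴿ} {m} (code : ∀ x → P x → Fin m) →
  (∀ {x y} (px : P x) (py : P y) → R x y → code x px ≢ code y py) →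
  ∀ {xs} → All P xs → AllPairs R xs → length xs ≤ m
length≤-by-code code separates {xs} pxs rxs = injective⇒≤ injective
  where
  codeAt : Fin (length xs) → Fin _
  codeAt i = code (List.lookup xs i) (All.lookup pxs (∈-lookup i))
  injective : ∀ {i j} → codeAt i ≡ codeAt j → i ≡ j
  injective {i} {j} eq with <-cmp i j
  ... | tri< i<j _ _ = ⊥-elim (separates _ _ (allPairs-lookup rxs i<j) eq)
  ... | tri≈ _ i≡j _ = i≡j
  ... | tri> _ _ j<i = ⊥-elim (separates _ _ (allPairs-lookup rxs j<i) (sym eq))

SimplexSet : ∀ {k n} → Vertex k n → Vertex k n → VSet k n
SimplexSet v w u = u ≡ v ⊎ ∃ λ i → u ≡ v [ i ]≔ lookup w i

same-simplex : ∀ {k n} {E F : VSet k n} {v w : Vertex k n} →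
  (∀ u → E u ⇔ SimplexSet v w u) → (∀ u → F u ⇔ SimplexSet v w u) → ∀ u → E u ⇔ F u
same-simplex E≐ F≐ u =
  mk⇔ (Equivalence.from (F≐ u) ∘ Equivalence.to (E≐ u))
      (Equivalence.from (E≐ u) ∘ Equivalence.to (F≐ u))

module EdgeGeometry {k n} {E : VSet k n} (edge : IsEdge E) where

  apex far : Vertex k n
  apex = proj₁ edge
  far = proj₁ (proj₂ edge)

  tip : Fin k → Vertex k n
  tip l = apex [ l ]≔ lookup far l

  private
    apex<far : ∀ l → lookup apex l <ᶠ lookup far l
    apex<far = proj₁ (proj₂ (proj₂ edge))

    members : ∀ u → E u → SimplexSet apex far u
    members u = Equivalence.to (proj₂ (proj₂ (proj₂ edge)) u)

  off-apex⇒tip : ∀ {P} l → E P → lookup P l ≢ lookup apex l → P ≡ tip l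
  off-apex⇒tip {P} l EP off with members P EP
  ... | inj₁ refl = ⊥-elim (off refl)
  ... | inj₂ (m , refl) with m ≟ l
  ...   | yes refl = refl
  ...   | no m≢l = ⊥-elim (off (lookup∘update′ (m≢l ∘ sym) apex (lookup far m)))

  apex-below : ∀ {P} l → E P → lookup apex l ≤ᶠ lookup P l
  apex-below {P} l EP with members P EP
  ... | inj₁ refl = ≤ᶠ-refl
  ... | inj₂ (m , refl) with m ≟ l
  ...   | yes refl = subst (lookup apex m ≤ᶠ_) (sym (lookup∘update m apex (lookup far m)))
                           (<⇒≤ (apex<far m))
  ...   | no m≢l = ≤ᶠ-reflexive (sym (lookup∘update′ (m≢l ∘ sym) apex (lookup far m)))

  off-apex-unique : ∀ {P Q} l → E P → E Q → lookup P l ≢ lookup apex l →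
    lookup Q l ≢ lookup apex l → P ≡ Q
  off-apex-unique l EP EQ P-off Q-off = trans (off-apex⇒tip l EP P-off) (sym (off-apex⇒tip l EQ Q-off))

  one-on-apex : ∀ {P Q} l → E P → E Q → lookup P l ≢ lookup Q l →
    lookup P l ≡ lookup apex l ⊎ lookup Q l ≡ lookup apex l
  one-on-apex {P} {Q} l EP EQ P≢Q with lookup P l ≟ lookup apex l | lookup Q l ≟ lookup apex l
  ... | yes P-on | _ = inj₁ P-on
  ... | no _ | yes Q-on = inj₂ Q-on
  ... | no P-off | no Q-off = ⊥-elim (P≢Q (cong (λ z → lookup z l) (off-apex-unique l EP EQ P-off Q-off)))

  -- Then the other one is the l-th tip, so every third member carries the apex value at l.
  third-on-apex : ∀ {P Q R} l → E P → E Q → E R → R ≢ P → R ≢ Q →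
    lookup P l ≢ lookup Q l → lookup R l ≡ lookup apex l
  third-on-apex {P} {Q} {R} l EP EQ ER R≢P R≢Q P≢Q with lookup R l ≟ lookup apex l | one-on-apex l EP EQ P≢Q
  ... | yes R-on | _ = R-on
  ... | no R-off | inj₁ P-on =
    ⊥-elim (R≢Q (off-apex-unique l ER EQ R-off (λ Q-on → P≢Q (trans P-on (sym Q-on)))))
  ... | no R-off | inj₂ Q-on =
    ⊥-elim (R≢P (off-apex-unique l ER EP R-off (λ P-on → P≢Q (trans P-on (sym Q-on)))))

LeastOf : ∀ {m} → Fin m → Fin m → Fin m → Set
LeastOf x p q = (x ≡ p ⊎ x ≡ q) × x ≤ᶠ p × x ≤ᶠ q

least-unique : ∀ {m} {x y p q : Fin m} → LeastOf x p q → LeastOf y p q → x ≡ y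
least-unique (inj₁ refl , _) (inj₁ refl , _) = refl
least-unique (inj₂ refl , _) (inj₂ refl , _) = refl
least-unique (inj₁ refl , _ , x≤q) (inj₂ refl , y≤p , _) = ≤ᶠ-antisym x≤q y≤p
least-unique (inj₂ refl , x≤p , _) (inj₁ refl , _ , y≤q) = ≤ᶠ-antisym x≤p y≤q

module _ {k n} (x : Vertex k n) where

  -- Code of an edge through x: its role for x (apex, or i-th tip) and its far
  -- vertex, with the i-th entry exchanged with the apex in the tip case.
  edgeCode : (E : VSet k n) → IsEdge E × E x → Fin (suc k * n ^ k)
  edgeCode E ((v , w , _ , E≐) , Ex) with Equivalence.to (E≐ x) Ex
  ... | inj₁ _ = pairIndex {suc k} zero w
  ... | inj₂ (i , _) = pairIndex {suc k} (suc i) (proj₂ (swapAt i (v , w)))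

  tip-determines-simplex : ∀ i {v w v' w' : Vertex k n} →
    x ≡ proj₁ (swapAt i (v , w)) → x ≡ proj₁ (swapAt i (v' , w')) →
    proj₂ (swapAt i (v , w)) ≡ proj₂ (swapAt i (v' , w')) → (v , w) ≡ (v' , w')
  tip-determines-simplex i {v} {w} {v'} {w'} x≡ x≡′ far≡ = begin
    (v , w)                          ≡⟨ sym (swapAt-involutive i (v , w)) ⟩
    swapAt i (swapAt i (v , w))      ≡⟨ cong (swapAt i) (cong₂ _,_ (trans (sym x≡) x≡′) far≡) ⟩
    swapAt i (swapAt i (v' , w'))    ≡⟨ swapAt-involutive i (v' , w') ⟩
    (v' , w')                        ∎
    where open ≡-Reasoning

  edgeCode-separates : ∀ {E F} (pe : IsEdge E × E x) (pf : IsEdge F × F x) →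
    DistinctSets E F → edgeCode E pe ≢ edgeCode F pf
  edgeCode-separates ((v , w , _ , E≐) , Ex) ((v' , w' , _ , F≐) , Fx) E≠F eq
    with Equivalence.to (E≐ x) Ex | Equivalence.to (F≐ x) Fx
  ... | inj₁ x≡v | inj₁ x≡v' with pairIndex-injective {suc k} zero zero w w' eq
  ...   | _ , refl with trans (sym x≡v) x≡v'
  ...     | refl = E≠F (same-simplex {v = v} {w = w} E≐ F≐)
  edgeCode-separates ((v , w , _) , _) ((v' , w' , _) , _) _ eq | inj₁ _ | inj₂ (i' , _)
    with pairIndex-injective zero (suc i') w (proj₂ (swapAt i' (v' , w'))) eq
  ...   | () , _
  edgeCode-separates ((v , w , _) , _) ((v' , w' , _) , _) _ eq | inj₂ (i , _) | inj₁ _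
    with pairIndex-injective (suc i) zero (proj₂ (swapAt i (v , w))) w' eq
  ...   | () , _
  edgeCode-separates ((v , w , _ , E≐) , _) ((v' , w' , _ , F≐) , _) E≠F eq
    | inj₂ (i , x≡tip) | inj₂ (i' , x≡tip')
    with pairIndex-injective (suc i) (suc i') (proj₂ (swapAt i (v , w))) (proj₂ (swapAt i' (v' , w'))) eq
  ...   | refl , far≡ with tip-determines-simplex i {v} {w} {v'} {w'} x≡tip x≡tip' far≡
  ...     | refl = E≠F (same-simplex {v = v} {w = w} E≐ F≐)

  degree-bound : ∀ m → DegreeAtLeast x m → m ≤ suc k * n ^ k
  degree-bound m (Es , refl , edges , distinct) =
    length≤-by-code edgeCode edgeCode-separates edges distinct

module _ {k n} (S : VSet k n) where

  RisesAbove : Vertex k n → Fin k → Set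
  RisesAbove x i = ∃ λ t → lookup x i <ᶠ t × S (x [ i ]≔ t)

  EdgeFree : Set₁
  EdgeFree = (E : VSet k n) → IsEdge E → ¬ ((u : Vertex k n) → E u → S u)

  rises-everywhere⇒edge : ∀ {x} → S x → (∀ i → RisesAbove x i) → ¬ EdgeFree
  rises-everywhere⇒edge {x} Sx rises edgeFree =
    edgeFree (SimplexSet x w) (x , w , x<w , λ u → mk⇔ (λ e → e) (λ e → e)) inS
    where
    w : Vertex k n
    w = tabulate (λ i → proj₁ (rises i))
    x<w : ∀ i → lookup x i <ᶠ lookup w i
    x<w i = subst (lookup x i <ᶠ_) (sym (lookup∘tabulate _ i)) (proj₁ (proj₂ (rises i)))
    inS : ∀ u → SimplexSet x w u → S u
    inS u (inj₁ refl) = Sx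
    inS u (inj₂ (i , refl)) =
      subst (λ t → S (x [ i ]≔ t)) (sym (lookup∘tabulate _ i)) (proj₂ (proj₂ (rises i)))

  top-direction : (∀ u → Dec (S u)) → EdgeFree → ∀ {x} → S x → ∃ λ i → ¬ RisesAbove x i
  top-direction S? edgeFree {x} Sx =
    ¬∀⟶∃¬ k (RisesAbove x) risesAbove? (λ rises → rises-everywhere⇒edge Sx rises edgeFree)
    where
    risesAbove? : ∀ i → Dec (RisesAbove x i)
    risesAbove? i = any? (λ t → (lookup x i <ᶠ? t) ×-dec S? (x [ i ]≔ t))

module _ {k n} (S : VSet (suc k) n) where

  tops-coincide : ∀ {x y} i → S x → S y → ¬ RisesAbove S x i → ¬ RisesAbove S y i →
    removeAt x i ≡ removeAt y i → x ≡ y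
  tops-coincide {x} {y} i Sx Sy x-top y-top e with <-cmp (lookup x i) (lookup y i)
  ... | tri< x<y _ _ = ⊥-elim (x-top (lookup y i , x<y , subst S (same-line x y i e) Sy))
  ... | tri> _ _ y<x = ⊥-elim (y-top (lookup x i , y<x , subst S (same-line y x i (sym e)) Sx))
  ... | tri≈ _ xᵢ≡yᵢ _ = sym (begin
    y                     ≡⟨ same-line x y i e ⟩
    x [ i ]≔ lookup y i   ≡⟨ cong (x [ i ]≔_) (sym xᵢ≡yᵢ) ⟩
    x [ i ]≔ lookup x i   ≡⟨ []≔-lookup x i ⟩
    x                     ∎)
    where open ≡-Reasoning

  lineCode : Vertex (suc k) n → Fin (suc k) → Fin (suc k * n ^ k)
  lineCode x i = pairIndex i (removeAt x i)

  lineCode-injective : ∀ {x y i j} → S x → S y → ¬ RisesAbove S x i → ¬ RisesAbove S y j →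
    lineCode x i ≡ lineCode y j → x ≡ y
  lineCode-injective {x} {y} {i} {j} Sx Sy x-top y-top eq
    with pairIndex-injective i j (removeAt x i) (removeAt y j) eq
  ... | refl , e = tops-coincide _ Sx Sy x-top y-top e

independent-bound : ∀ {k n} (xs : List (Vertex (suc k) n)) → Unique xs → Independent xs →
  length xs ≤ suc k * n ^ k
independent-bound {k} {n} xs unique independent =
  length≤-by-code code separates (All.tabulate (λ x∈ → x∈)) unique
  where
  S : VSet (suc k) n
  S = _∈ xs
  S? : ∀ u → Dec (S u)
  S? u = _∈?_ (≡-dec _≟_) u xs
  top : ∀ {x} → S x → ∃ λ i → ¬ RisesAbove S x i
  top = top-direction S S? independent
  code : ∀ x → S x → Fin (suc k * n ^ k)
  code x Sx = lineCode S x (proj₁ (top Sx))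
  separates : ∀ {x y} (Sx : S x) (Sy : S y) → x ≢ y → code x Sx ≢ code y Sy
  separates Sx Sy x≢y eq = x≢y (lineCode-injective S Sx Sy (proj₂ (top Sx)) (proj₂ (top Sy)) eq)

-- Every colour class has at most k·n^(k-1) vertices, so n^k ≤ m·k·n^(k-1).
colouring-bound : ∀ {k n m} (c : Vertex (suc k) n → Fin m) → ProperColouring (suc k) n m c →
  n ^ suc k ≤ m * (suc k * n ^ k)
colouring-bound {k} {n} {m} c proper =
  injective⇒≤ {f = code ∘ vertexOf} (vertexOf-injective ∘ code-injective)
  where
  class : Fin m → VSet (suc k) n
  class j u = c u ≡ j
  top : ∀ x → ∃ λ i → ¬ RisesAbove (class (c x)) x i
  top x = top-direction (class (c x)) (λ u → c u ≟ c x) (λ E e inside → proper E e (c x , inside)) refl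
  code : Vertex (suc k) n → Fin (m * (suc k * n ^ k))
  code x = combine {m} (c x) (lineCode (class (c x)) x (proj₁ (top x)))
  code-injective : ∀ {x y} → code x ≡ code y → x ≡ y
  code-injective {x} {y} eq with combine-injective {m} _ _ _ _ eq
  ... | cx≡cy , e = lineCode-injective (class (c y)) {i = proj₁ (top x)} {j = proj₁ (top y)} cx≡cy refl
    (subst (λ j → ¬ RisesAbove (class j) x (proj₁ (top x))) cx≡cy (proj₂ (top x))) (proj₂ (top y)) e

all-toList-lookup : ∀ {m} {P : A → Set ℓᴾ} (xs : Vec A m) → All P (toList xs) → ∀ i → P (lookup xs i)
all-toList-lookup xs h i = All.lookup h (VecMembership.∈-toList⁺ (VecMembership.∈-lookup i xs))

no-T : ∀ {k n} → ¬ ContainsT (suc (suc k)) n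
no-T {k} {n} (s₀ ∷ s₁ ∷ ss , a , (s₀≢s₁ All.∷ s₀-fresh) ∷ s₁-fresh ∷ _ , sides , top) =
  top-separates top
  where
  a≢s₀ : ∀ i → lookup a i ≢ s₀
  a≢s₀ i = all-toList-lookup a (++⁻ʳ (toList ss) s₀-fresh) i ∘ sym
  a≢s₁ : ∀ i → lookup a i ≢ s₁
  a≢s₁ i = all-toList-lookup a (++⁻ʳ (toList ss) s₁-fresh) i ∘ sym

  l : Fin (suc (suc k))
  l = proj₁ (differing-coordinate _≟_ s₀≢s₁)
  s₀≢s₁-at-l : lookup s₀ l ≢ lookup s₁ l
  s₀≢s₁-at-l = proj₂ (differing-coordinate _≟_ s₀≢s₁)

  side-at-l : ∀ i → let v = EdgeGeometry.apex (sides i) in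
    lookup (lookup a i) l ≡ lookup v l × LeastOf (lookup v l) (lookup s₀ l) (lookup s₁ l)
  side-at-l i =
    third-on-apex l s₀∈ s₁∈ (inj₂ refl) (a≢s₀ i) (a≢s₁ i) s₀≢s₁-at-l ,
    Sum.map sym sym (one-on-apex l s₀∈ s₁∈ s₀≢s₁-at-l) , apex-below l s₀∈ , apex-below l s₁∈
    where
    open EdgeGeometry (sides i)
    s₀∈ = inj₁ (zero , refl)
    s₁∈ = inj₁ (suc zero , refl)

  a-agree : ∀ i j → lookup (lookup a i) l ≡ lookup (lookup a j) l
  a-agree i j = trans (proj₁ (side-at-l i))
    (trans (least-unique (proj₂ (side-at-l i)) (proj₂ (side-at-l j))) (sym (proj₁ (side-at-l j))))

  -- But the edge {a_1,…,a_{k+1}} contains its apex and its l-th tip, which differ at l.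
  top-separates : ¬ IsEdge (λ u → ∃ λ j → u ≡ lookup a j)
  top-separates (u , z , u<z , A≐) with Equivalence.from (A≐ u) (inj₁ refl)
                                      | Equivalence.from (A≐ (u [ l ]≔ lookup z l)) (inj₂ (l , refl))
  ... | i , u≡aᵢ | j , tip≡aⱼ = <-irrefl u≡z (u<z l)
    where
    u≡z : lookup u l ≡ lookup z l
    u≡z = trans (cong (λ v → lookup v l) u≡aᵢ)
          (trans (a-agree i j)
          (trans (cong (λ v → lookup v l) (sym tip≡aⱼ)) (lookup∘update l u (lookup z l))))

^-distribʳ-* : ∀ x y k → (x * y) ^ k ≡ x ^ k * y ^ k
^-distribʳ-* x y zero = refl
^-distribʳ-* x y (suc k) = trans (cong (x * y *_) (^-distribʳ-* x y k)) (shuffle x y (x ^ k) (y ^ k))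
  where
  shuffle : ∀ x y p q → x * y * (p * q) ≡ x * p * (y * q)
  shuffle = solve-∀

power-scaling : ∀ k {x y z m d e} → x * y ≤ m * z → d ≤ e * y ^ k →
  x ^ k * d ≤ m ^ k * e * z ^ k
power-scaling k {x} {y} {z} {m} {d} {e} xy≤mz d≤ = begin
  x ^ k * d            ≤⟨ *-monoʳ-≤ (x ^ k) d≤ ⟩
  x ^ k * (e * y ^ k)  ≡⟨ shuffle (x ^ k) e (y ^ k) ⟩
  e * (x ^ k * y ^ k)  ≡⟨ cong (e *_) (sym (^-distribʳ-* x y k)) ⟩
  e * (x * y) ^ k      ≤⟨ *-monoʳ-≤ e (^-monoˡ-≤ k xy≤mz) ⟩
  e * (m * z) ^ k      ≡⟨ cong (e *_) (^-distribʳ-* m z k) ⟩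
  e * (m ^ k * z ^ k)  ≡⟨ shuffle e (m ^ k) (z ^ k) ⟩
  m ^ k * (e * z ^ k)  ≡⟨ sym (*-assoc (m ^ k) e (z ^ k)) ⟩
  m ^ k * e * z ^ k    ∎
  where
  open ≤-Reasoning
  shuffle : ∀ p e q → p * (e * q) ≡ e * (p * q)
  shuffle = solve-∀

≤-double : ∀ k X {a} → a ≤ k * X → a ≤ 2 * k * X
≤-double k X a≤ = ≤-trans a≤ (*-monoˡ-≤ X (m≤m+n k (k + 0)))

≤-times-base : ∀ c n k {a} → a ≤ c * n ^ k → a * n ≤ c * n ^ suc k
≤-times-base c n k a≤ = ≤-trans (*-monoˡ-≤ n a≤) (≤-reflexive (shuffle c (n ^ k) n))
  where
  shuffle : ∀ c X n → c * X * n ≡ c * (n * X)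
  shuffle = solve-∀

cancel-power : ∀ k n m → 1 ≤ n → n ^ suc k ≤ m * (suc k * n ^ k) → n ≤ suc k * m
cancel-power k n@(suc _) m _ le = *-cancelʳ-≤ n (suc k * m) (n ^ k) {{m^n≢0 n k}}
  (≤-trans le (≤-reflexive (shuffle m (suc k) (n ^ k))))
  where
  shuffle : ∀ m k X → m * (k * X) ≡ k * m * X
  shuffle = solve-∀

mainTheorem3 : (k n : ℕ) → 2 ≤ k → 1 ≤ n →
    (Fin (n ^ k) ↔ Vertex k n) ×
    ((d : ℕ) → IsMaxDegree k n d → d ≤ (k + 1) * n ^ k) ×
    ((a : ℕ) → IsIndependenceNumber k n a → a ≤ 2 * k * n ^ (k ∸ 1)) ×
    ((a d : ℕ) → IsIndependenceNumber k n a → IsMaxDegree k n d →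
    a ^ k * d ≤ (2 * k) ^ k * (k + 1) * (n ^ k) ^ k) ×
    ((c d : ℕ) → IsChromaticNumber k n c → IsMaxDegree k n d →
    d ≤ (2 * k) ^ k * (k + 1) * c ^ k) ×
    ¬ ContainsT k n
mainTheorem3 k@(suc k′@(suc _)) n (s≤s (s≤s z≤n)) 1≤n =
  vertexBijection k n , Δ-bound , α-bound , αΔ-bound , χΔ-bound , no-T
  where
  Δ-bound : (d : ℕ) → IsMaxDegree k n d → d ≤ (k + 1) * n ^ k
  Δ-bound d ((x , deg) , _) = subst (λ e → d ≤ e * n ^ k) (+-comm 1 k) (degree-bound x d deg)
  α-bound : (a : ℕ) → IsIndependenceNumber k n a → a ≤ 2 * k * n ^ k′
  α-bound a ((xs , unique , independent , refl) , _) =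
    ≤-double k (n ^ k′) (independent-bound xs unique independent)
  αΔ-bound : (a d : ℕ) → IsIndependenceNumber k n a → IsMaxDegree k n d →
    a ^ k * d ≤ (2 * k) ^ k * (k + 1) * (n ^ k) ^ k
  αΔ-bound a d α Δ = power-scaling k {a} {n} {n ^ k} {2 * k}
    (≤-times-base (2 * k) n k′ (α-bound a α)) (Δ-bound d Δ)
  χΔ-bound : (c d : ℕ) → IsChromaticNumber k n c → IsMaxDegree k n d →
    d ≤ (2 * k) ^ k * (k + 1) * c ^ k
  χΔ-bound c d ((colouring , proper) , _) Δ =
    subst (_≤ (2 * k) ^ k * (k + 1) * c ^ k) (trans (cong (_* d) (^-zeroˡ k)) (*-identityˡ d))
      (power-scaling k {1} {n} {c} {2 * k} n≤2kc (Δ-bound d Δ))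
    where
    n≤2kc : 1 * n ≤ 2 * k * c
    n≤2kc = ≤-trans (≤-reflexive (*-identityˡ n))
      (≤-double k c (cancel-power k′ n c 1≤n (colouring-bound colouring proper)))
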